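{- For every weight function $(w,w_0)$, quasi-precedence $\succsim$ and status $\sigma$, the order $\succ_{\mathrm{WPO}(\mathcal A_{\mathrm{sum}})}$ is a reduction order.
   Context: Terms over a finite signature $\Sigma$ and variables $\mathcal V$. A weight function $(w,w_0)$: $w:\Sigma\to\mathbb N$, $w_0\in\mathbb N$ with $w(c)\ge w_0$ for constants (no admissibility and no positivity of $w_0$ required). $\mathcal A_{\mathrm{sum}}$: carrier $\{a\in\mathbb N\mid a\ge w_0\}$, usual $\ge,>$, $f_{\mathcal A}(a_1..a_n)=w(f)+\sum_ia_i$; on terms $s\ge_{\mathcal A}t$ ($>_{\mathcal A}$) iff $\hat\alpha(s)\ge\hat\alpha(t)$ ($>$) for all assignments $\alpha$. Quasi-precedence: quasi-order $\succsim$ on $\Sigma$ with well-founded strict part $\succ$, equivalence $\sim$. Status $\sigma$: $f\in\Sigma_n\mapsto$ permutation $[i_1..i_n]$, $\sigma(f)(s_1..s_n)=[s_{i_1},..,s_{i_n}]$. Lex extension of strict $\succ$ (reflexive closure $\succeq$): $[s_1..s_n]\succ^{\mathrm{lex}}[t_1..t_m]$ iff there is $k<n$ with $s_i\succeq t_i$ ($i\le k$) and either $k=m$, or $k<m$ and $s_{k+1}\succ t_{k+1}$. WPO: no variable is greater than any term; $s=f(s_1..s_n)\succ_{\mathrm{WPO}(\mathcal A)}t$ iff (1) $s>_{\mathcal A}t$, or (2) $s\ge_{\mathcal A}t$ and either $s_i\succeq_{\mathrm{WPO}(\mathcal A)}t$ for some $i$, or $t=g(t_1..t_m)$, $s\succ_{\mathrm{WPO}(\mathcal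 A)}t_j$ for all $j$, and $f\succ g$ or ($f\sim g$ and $\sigma(f)(\vec s)\succ^{\mathrm{lex}}_{\mathrm{WPO}(\mathcal A)}\sigma(g)(\vec t)$). A reduction order is a well-founded strict order on terms that is monotonic ($s\succ t\Rightarrow f(\dots,s,\dots)\succ f(\dots,t,\dots)$) and stable ($s\succ t\Rightarrow s\theta\succ t\theta$ for all substitutions). -}

module Defs where

open import Level using (0ℓ)
open import Data.Nat using (ℕ; zero; suc; _+_; _≤_; _<_)
open import Data.Fin using (Fin)
open import Data.Fin.Permutation using (Permutation′; _⟨$⟩ʳ_)
open import Data.Vec using (Vec; []; _∷_; lookup; tabulate; toList; _[_]≔_)
open import Data.List using (List; []; _∷_)
open import Data.Product using (_×_; ∃)
open import Data.Sum using (_⊎_)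
open import Function using (flip)
open import Relation.Nullary using (¬_)
open import Relation.Binary.Core using (Rel)
open import Relation.Binary.Structures using (IsPreorder; IsStrictPartialOrder)
open import Relation.Binary.PropositionalEquality using (_≡_)
open import Induction.WellFounded using (WellFounded)

-- Lexicographic extension of a strict relation _≻_ on lists, exactly as
-- in the paper:  [s1..sn] ≻lex [t1..tm]  iff there is k < n with
-- s_i ⪰ t_i (i ≤ k) and either k = m, or k < m and s_{k+1} ≻ t_{k+1},
-- where ⪰ is the reflexive closure of ≻.  Given inductively on k.

module _ {A : Set} (_≻_ : Rel A 0ℓ) where

  data Lex : List A → List A → Set where
    lex-done : ∀ {x xs} → Lex (x ∷ xs) []
    lex-here : ∀ {x xs y ys} → x ≻ y → Lex (x ∷ xs) (y ∷ ys)
    lex-next : ∀ {x xs y ys} → (x ≻ y ⊎ x ≡ y) → Lex xs ys → Lex (x ∷ xs) (y ∷ ys)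

module Terms {nΣ : ℕ} (ar : Fin nΣ → ℕ) (V : Set) where

  data Term : Set where
    var : V → Term
    fun : (f : Fin nΣ) → Vec Term (ar f) → Term

  Subst : Set
  Subst = V → Term

  mutual
    _⟨_⟩ : Term → Subst → Term
    var x    ⟨ θ ⟩ = θ x
    fun f ts ⟨ θ ⟩ = fun f (substs ts θ)

    substs : ∀ {k} → Vec Term k → Subst → Vec Term k
    substs []       θ = []
    substs (t ∷ ts) θ = (t ⟨ θ ⟩) ∷ substs ts θ

  record IsReductionOrder (_≻_ : Rel Term 0ℓ) : Set where
    field
      isStrictOrder : IsStrictPartialOrder _≡_ _≻_
      wellFounded   : WellFounded (flip _≻_)
      monotonic     : ∀ {s t} → s ≻ t → ∀ f (us : Vec Term (ar f)) (i : Fin (ar f)) →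
                      fun f (us [ i ]≔ s) ≻ fun f (us [ i ]≔ t)
      stable        : ∀ {s t} → s ≻ t → (θ : Subst) → (s ⟨ θ ⟩) ≻ (t ⟨ θ ⟩)

  record WeightFunction : Set where
    field
      w         : Fin nΣ → ℕ
      w₀        : ℕ
      constants : ∀ f → ar f ≡ 0 → w₀ ≤ w f

  module _ (_≿_ : Rel (Fin nΣ) 0ℓ) where
    StrictPart : Rel (Fin nΣ) 0ℓ
    StrictPart f g = f ≿ g × ¬ (g ≿ f)

    EquivPart : Rel (Fin nΣ) 0ℓ
    EquivPart f g = f ≿ g × g ≿ f

  record QuasiPrecedence : Set₁ where
    field
      _≿_          : Rel (Fin nΣ) 0ℓ
      isPreorder   : IsPreorder _≡_ _≿_
      wfStrictPart : WellFounded (flip (StrictPart _≿_))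

  Status : Set
  Status = (f : Fin nΣ) → Permutation′ (ar f)

  applyStatus : Status → (f : Fin nΣ) → Vec Term (ar f) → List Term
  applyStatus σ f ss = toList (tabulate (λ k → lookup ss (σ f ⟨$⟩ʳ k)))

  -- The algebra A_sum: carrier {a ∈ ℕ | a ≥ w0}, f_A(a..) = w(f) + Σ a_i.

  module Sum (W : WeightFunction) where
    open WeightFunction W

    Assignment : Set
    Assignment = V → ℕ

    InCarrier : Assignment → Set
    InCarrier α = ∀ x → w₀ ≤ α x

    mutual
      eval : Assignment → Term → ℕ
      eval α (var x)    = α x
      eval α (fun f ts) = w f + evalSum α ts

      evalSum : ∀ {k} → Assignment → Vec Term k → ℕ
      evalSum α []       = 0
      evalSum α (t ∷ ts) = eval α t + evalSum α ts

    _≥A_ : Rel Term 0ℓ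
    s ≥A t = ∀ α → InCarrier α → eval α t ≤ eval α s

    _>A_ : Rel Term 0ℓ
    s >A t = ∀ α → InCarrier α → eval α t < eval α s

  module WPO (W : WeightFunction) (P : QuasiPrecedence) (σ : Status) where
    open Sum W
    open QuasiPrecedence P

    mutual
      data _≻WPO_ : Rel Term 0ℓ where
        wpo1  : ∀ {f ss t} → fun f ss >A t → fun f ss ≻WPO t
        wpo2a : ∀ {f ss t} → fun f ss ≥A t →
                (i : Fin (ar f)) → lookup ss i ⪰WPO t → fun f ss ≻WPO t
        wpo2b : ∀ {f ss g ts} → fun f ss ≥A fun g ts →
                (∀ j → fun f ss ≻WPO lookup ts j) →
                StrictPart _≿_ f g → fun f ss ≻WPO fun g ts
        wpo2c : ∀ {f ss g ts} → fun f ss ≥A fun g ts →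
                (∀ j → fun f ss ≻WPO lookup ts j) →
                EquivPart _≿_ f g →
                Lex _≻WPO_ (applyStatus σ f ss) (applyStatus σ g ts) →
                fun f ss ≻WPO fun g ts

      _⪰WPO_ : Rel Term 0ℓ
      s ⪰WPO t = s ≻WPO t ⊎ s ≡ t

-- Transitivity, stability and monotonicity follow by induction on
-- derivations, since ≥A and >A are transitive, closed under substitution
-- and monotone. For well-foundedness, a term f(s₁..sₙ) with strongly
-- normalising arguments is shown strongly normalising by a lexicographic
-- induction on its value under the least assignment x ↦ w₀, the
-- precedence of f, and the status list σ(f)(s₁..sₙ), ordered by the
-- lexicographic extension restricted to lists of length at most the
-- maximal arity with strongly normalising entries.

module Submission where

open import Defs
open import Level using (0ℓ)
open import Data.Nat using (ℕ; suc; _+_; _≤_; _<_; s≤s)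
open import Data.Nat.Properties
  using (≤-refl; ≤-trans; <-≤-trans; ≤-<-trans; <⇒≤; m≤m+n; m≤n+m; +-monoˡ-≤; +-monoʳ-≤)
open import Data.Nat.Induction using (<-wellFounded)
open import Data.Fin as F using (Fin)
open import Data.Fin.Permutation using (_⟨$⟩ʳ_; _⟨$⟩ˡ_; inverseʳ)
open import Data.Vec as Vec using (Vec; []; _∷_; lookup; tabulate; toList; _[_]≔_)
open import Data.Vec.Properties using (lookup∘update; toList-map; tabulate-∘; tabulate-cong; length-toList)
open import Data.Vec.Relation.Unary.All.Properties using (tabulate⁺; toList⁺)
open import Data.List as List using (List; []; _∷_; length; allFin)
open import Data.List.Extrema.Nat using (max; xs≤max)
open import Data.List.Membership.Propositional.Properties using (∈-map⁺; ∈-allFin)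
open import Data.List.Relation.Unary.All as All using (All; []; _∷_)
open import Data.Product using (_×_; _,_)
open import Data.Sum using (_⊎_; inj₁; inj₂)
open import Function using (flip; _∘_)
open import Relation.Binary.Core using (Rel)
open import Relation.Binary.Structures using (IsPreorder)
open import Relation.Binary.PropositionalEquality
  using (_≡_; refl; sym; cong; cong₂; subst; subst₂; resp₂; module ≡-Reasoning)
open import Relation.Binary.PropositionalEquality.Properties using () renaming (isEquivalence to ≡-isEquivalence)
open import Induction.WellFounded using (WellFounded; Acc; acc; wf⇒irrefl)

module _ {A : Set} {_≻_ : Rel A 0ℓ} where

  lex-tabulate : ∀ {n} {a b : Fin n → A} → (∀ k → a k ≻ b k ⊎ a k ≡ b k) →
                 ∀ k → a k ≻ b k → Lex _≻_ (toList (tabulate a)) (toList (tabulate b))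
  lex-tabulate a⪰b F.zero    a≻b = lex-here a≻b
  lex-tabulate a⪰b (F.suc k) a≻b = lex-next (a⪰b F.zero) (lex-tabulate (a⪰b ∘ F.suc) k a≻b)

  update-⪰ : ∀ {n s t} → s ≻ t → (us : Vec A n) (i j : Fin n) →
             lookup (us [ i ]≔ s) j ≻ lookup (us [ i ]≔ t) j ⊎ lookup (us [ i ]≔ s) j ≡ lookup (us [ i ]≔ t) j
  update-⪰ s≻t (u ∷ us) F.zero    F.zero    = inj₁ s≻t
  update-⪰ s≻t (u ∷ us) F.zero    (F.suc j) = inj₂ refl
  update-⪰ s≻t (u ∷ us) (F.suc i) F.zero    = inj₂ refl
  update-⪰ s≻t (u ∷ us) (F.suc i) (F.suc j) = update-⪰ s≻t us i j

module _ {A : Set} (_≻_ : Rel A 0ℓ) where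

  LexDomain : ℕ → List A → Set
  LexDomain B xs = length xs ≤ B × All (Acc (flip _≻_)) xs

  -- Without the length bound Lex is not well-founded:
  -- [b] ≻lex [a , b] ≻lex [a , a , b] ≻lex … whenever b ≻ a.
  BoundedLex : ℕ → Rel (List A) 0ℓ
  BoundedLex B ys xs = Lex _≻_ xs ys × LexDomain B ys

  private
    []-acc : ∀ {B} → Acc (BoundedLex B) []
    []-acc = acc λ { (() , _) }

    mutual
      ∷-acc : ∀ {B} → (∀ xs → LexDomain B xs → Acc (BoundedLex B) xs) →
              ∀ {x xs} → Acc (flip _≻_) x → Acc (BoundedLex B) xs → Acc (BoundedLex (suc B)) (x ∷ xs)
      ∷-acc acc-B x-acc xs-acc = acc (below-∷ acc-B x-acc xs-acc)

      below-∷ : ∀ {B} → (∀ xs → LexDomain B xs → Acc (BoundedLex B) xs) →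
                ∀ {x xs} → Acc (flip _≻_) x → Acc (BoundedLex B) xs →
                ∀ {ys} → BoundedLex (suc B) ys (x ∷ xs) → Acc (BoundedLex (suc B)) ys
      below-∷ acc-B _ _ {[]} _ = []-acc
      below-∷ acc-B (acc <x) _ {y ∷ ys} (lex-here x≻y , s≤s |ys| , _ ∷ ys-acc) =
        ∷-acc acc-B (<x x≻y) (acc-B ys (|ys| , ys-acc))
      below-∷ acc-B (acc <x) _ {y ∷ ys} (lex-next (inj₁ x≻y) _ , s≤s |ys| , _ ∷ ys-acc) =
        ∷-acc acc-B (<x x≻y) (acc-B ys (|ys| , ys-acc))
      below-∷ acc-B x-acc (acc <xs) {y ∷ ys} (lex-next (inj₂ refl) xs≻ys , s≤s |ys| , _ ∷ ys-acc) =
        ∷-acc acc-B x-acc (<xs (xs≻ys , |ys| , ys-acc))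

  lexDomain-acc : ∀ B xs → LexDomain B xs → Acc (BoundedLex B) xs
  lexDomain-acc B       []       _                        = []-acc
  lexDomain-acc (suc B) (x ∷ xs) (s≤s |xs| , ax ∷ xs-acc) =
    ∷-acc (lexDomain-acc B) ax (lexDomain-acc B xs (|xs| , xs-acc))

module TermProperties {nΣ : ℕ} (ar : Fin nΣ → ℕ) (V : Set) where
  open Terms ar V

  module _ {P : Term → Set} (P-var : ∀ x → P (var x))
           (P-fun : ∀ f ts → (∀ j → P (lookup ts j)) → P (fun f ts)) where
    mutual
      term-induction : ∀ t → P t
      term-induction (var x)    = P-var x
      term-induction (fun f ts) = P-fun f ts (args-induction ts)

      args-induction : ∀ {k} (ts : Vec Term k) j → P (lookup ts j)
      args-induction (t ∷ ts) F.zero    = term-induction t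
      args-induction (t ∷ ts) (F.suc j) = args-induction ts j

  lookup-substs : ∀ {k} (ts : Vec Term k) i θ → lookup (substs ts θ) i ≡ lookup ts i ⟨ θ ⟩
  lookup-substs (t ∷ ts) F.zero    θ = refl
  lookup-substs (t ∷ ts) (F.suc i) θ = lookup-substs ts i θ

  applyStatus-substs : ∀ σ f ss θ → applyStatus σ f (substs ss θ) ≡ List.map (_⟨ θ ⟩) (applyStatus σ f ss)
  applyStatus-substs σ f ss θ = begin
    toList (tabulate (λ k → lookup (substs ss θ) (σ f ⟨$⟩ʳ k)))
      ≡⟨ cong toList (tabulate-cong (λ k → lookup-substs ss (σ f ⟨$⟩ʳ k) θ)) ⟩
    toList (tabulate ((_⟨ θ ⟩) ∘ (λ k → lookup ss (σ f ⟨$⟩ʳ k))))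
      ≡⟨ cong toList (tabulate-∘ (_⟨ θ ⟩) (λ k → lookup ss (σ f ⟨$⟩ʳ k))) ⟩
    toList (Vec.map (_⟨ θ ⟩) (tabulate (λ k → lookup ss (σ f ⟨$⟩ʳ k))))
      ≡⟨ toList-map (_⟨ θ ⟩) _ ⟩
    List.map (_⟨ θ ⟩) (applyStatus σ f ss) ∎
    where open ≡-Reasoning

  module QuasiPrecedenceProperties (P : QuasiPrecedence) where
    open QuasiPrecedence P
    open IsPreorder isPreorder using () renaming (refl to ≿-refl; trans to ≿-trans)

    ∼ₚ-refl : ∀ {f} → EquivPart _≿_ f f
    ∼ₚ-refl = ≿-refl , ≿-refl

    ∼ₚ-trans : ∀ {f g h} → EquivPart _≿_ f g → EquivPart _≿_ g h → EquivPart _≿_ f h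
    ∼ₚ-trans (f≿g , g≿f) (g≿h , h≿g) = ≿-trans f≿g g≿h , ≿-trans h≿g g≿f

    ≻ₚ-trans : ∀ {f g h} → StrictPart _≿_ f g → StrictPart _≿_ g h → StrictPart _≿_ f h
    ≻ₚ-trans (f≿g , g⋡f) (g≿h , _) = ≿-trans f≿g g≿h , λ h≿f → g⋡f (≿-trans g≿h h≿f)

    ∼ₚ-≻ₚ-trans : ∀ {f g h} → EquivPart _≿_ f g → StrictPart _≿_ g h → StrictPart _≿_ f h
    ∼ₚ-≻ₚ-trans (f≿g , g≿f) (g≿h , h⋡g) = ≿-trans f≿g g≿h , λ h≿f → h⋡g (≿-trans h≿f f≿g)

    ≻ₚ-∼ₚ-trans : ∀ {f g h} → StrictPart _≿_ f g → EquivPart _≿_ g h → StrictPart _≿_ f h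
    ≻ₚ-∼ₚ-trans (f≿g , g⋡f) (g≿h , h≿g) = ≿-trans f≿g g≿h , λ h≿f → g⋡f (≿-trans g≿h h≿f)

  module SumProperties (W : WeightFunction) where
    open WeightFunction W
    open Sum W

    ≥A-trans : ∀ s t u → s ≥A t → t ≥A u → s ≥A u
    ≥A-trans s t u s≥t t≥u α α∈ = ≤-trans (t≥u α α∈) (s≥t α α∈)

    >A-≥A-trans : ∀ s t u → s >A t → t ≥A u → s >A u
    >A-≥A-trans s t u s>t t≥u α α∈ = ≤-<-trans (t≥u α α∈) (s>t α α∈)

    ≥A->A-trans : ∀ s t u → s ≥A t → t >A u → s >A u
    ≥A->A-trans s t u s≥t t>u α α∈ = <-≤-trans (t>u α α∈) (s≥t α α∈)

    lookup≤evalSum : ∀ α {k} (ts : Vec Term k) i → eval α (lookup ts i) ≤ evalSum α ts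
    lookup≤evalSum α (t ∷ ts) F.zero    = m≤m+n _ _
    lookup≤evalSum α (t ∷ ts) (F.suc i) = ≤-trans (lookup≤evalSum α ts i) (m≤n+m _ _)

    evalSum-update-mono : ∀ α {k} (us : Vec Term k) i {s t} → eval α t ≤ eval α s →
                          evalSum α (us [ i ]≔ t) ≤ evalSum α (us [ i ]≔ s)
    evalSum-update-mono α (u ∷ us) F.zero    t≤s = +-monoˡ-≤ _ t≤s
    evalSum-update-mono α (u ∷ us) (F.suc i) t≤s = +-monoʳ-≤ (eval α u) (evalSum-update-mono α us i t≤s)

    mutual
      eval-⟨⟩ : ∀ α t θ → eval α (t ⟨ θ ⟩) ≡ eval (eval α ∘ θ) t
      eval-⟨⟩ α (var x)    θ = refl
      eval-⟨⟩ α (fun f ts) θ = cong (w f +_) (evalSum-substs α ts θ)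

      evalSum-substs : ∀ α {k} (ts : Vec Term k) θ → evalSum α (substs ts θ) ≡ evalSum (eval α ∘ θ) ts
      evalSum-substs α []       θ = refl
      evalSum-substs α (t ∷ ts) θ = cong₂ _+_ (eval-⟨⟩ α t θ) (evalSum-substs α ts θ)

    mutual
      eval-≥w₀ : ∀ {α} → InCarrier α → ∀ t → w₀ ≤ eval α t
      eval-≥w₀ α∈ (var x) = α∈ x
      eval-≥w₀ α∈ (fun f ts) with evalSum-≥w₀ α∈ ts
      ... | inj₁ ar≡0 = ≤-trans (constants f ar≡0) (m≤m+n _ _)
      ... | inj₂ w₀≤ = ≤-trans w₀≤ (m≤n+m _ _)

      evalSum-≥w₀ : ∀ {α} → InCarrier α → ∀ {k} (ts : Vec Term k) → k ≡ 0 ⊎ w₀ ≤ evalSum α ts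
      evalSum-≥w₀ α∈ []       = inj₁ refl
      evalSum-≥w₀ α∈ (t ∷ ts) = inj₂ (≤-trans (eval-≥w₀ α∈ t) (m≤m+n _ _))

    -- Evaluating t ⟨ θ ⟩ at α is evaluating t at eval α ∘ θ, which lies in
    -- the carrier by eval-≥w₀: this is where w(c) ≥ w₀ is needed.
    eval-stable : (_R_ : Rel ℕ 0ℓ) → ∀ s t → (∀ α → InCarrier α → eval α t R eval α s) →
                  ∀ θ α → InCarrier α → eval α (t ⟨ θ ⟩) R eval α (s ⟨ θ ⟩)
    eval-stable _R_ s t t-R-s θ α α∈ =
      subst₂ _R_ (sym (eval-⟨⟩ α t θ)) (sym (eval-⟨⟩ α s θ)) (t-R-s (eval α ∘ θ) (eval-≥w₀ α∈ ∘ θ))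

    least : Assignment
    least _ = w₀

    least-inCarrier : InCarrier least
    least-inCarrier _ = ≤-refl

  module WPOProperties (W : WeightFunction) (P : QuasiPrecedence) (σ : Status) where
    open WeightFunction W
    open Sum W
    open SumProperties W
    open QuasiPrecedence P
    open QuasiPrecedenceProperties P
    open WPO W P σ

    ≻⇒≥A : ∀ {s t} → s ≻WPO t → s ≥A t
    ≻⇒≥A (wpo1 s>t) α α∈     = <⇒≤ (s>t α α∈)
    ≻⇒≥A (wpo2a s≥t _ _)     = s≥t
    ≻⇒≥A (wpo2b s≥t _ _)     = s≥t
    ≻⇒≥A (wpo2c s≥t _ _ _)   = s≥t

    ≻-≻⇒≥A : ∀ {s t u} → s ≻WPO t → t ≻WPO u → s ≥A u
    ≻-≻⇒≥A {s} {t} {u} s≻t t≻u = ≥A-trans s t u (≻⇒≥A s≻t) (≻⇒≥A t≻u)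

    ≻-subterm : ∀ f ss i → fun f ss ≻WPO lookup ss i
    ≻-subterm f ss i = wpo2a (λ α _ → ≤-trans (lookup≤evalSum α ss i) (m≤n+m _ _)) i (inj₂ refl)

    mutual
      ≻-trans : ∀ {s t u} → s ≻WPO t → t ≻WPO u → s ≻WPO u
      ≻-trans {s} {t} {u} (wpo1 s>t) t≻u = wpo1 (>A-≥A-trans s t u s>t (≻⇒≥A t≻u))
      ≻-trans s≻t@(wpo2a _ i sᵢ⪰t) t≻u = wpo2a (≻-≻⇒≥A s≻t t≻u) i (inj₁ (⪰-≻-trans sᵢ⪰t t≻u))
      ≻-trans {s@(fun _ _)} {t} {u} s≻t (wpo1 t>u) = wpo1 (≥A->A-trans s t u (≻⇒≥A s≻t) t>u)
      ≻-trans (wpo2b _ s≻ts _)   (wpo2a _ j tⱼ⪰u) = ≻-⪰-trans (s≻ts j) tⱼ⪰u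
      ≻-trans (wpo2c _ s≻ts _ _) (wpo2a _ j tⱼ⪰u) = ≻-⪰-trans (s≻ts j) tⱼ⪰u
      ≻-trans s≻t@(wpo2b _ _ f≻g) t≻u@(wpo2b _ t≻us g≻h) =
        wpo2b (≻-≻⇒≥A s≻t t≻u) (≻-trans s≻t ∘ t≻us) (≻ₚ-trans f≻g g≻h)
      ≻-trans s≻t@(wpo2c _ _ f∼g _) t≻u@(wpo2b _ t≻us g≻h) =
        wpo2b (≻-≻⇒≥A s≻t t≻u) (≻-trans s≻t ∘ t≻us) (∼ₚ-≻ₚ-trans f∼g g≻h)
      ≻-trans s≻t@(wpo2b _ _ f≻g) t≻u@(wpo2c _ t≻us g∼h _) =
        wpo2b (≻-≻⇒≥A s≻t t≻u) (≻-trans s≻t ∘ t≻us) (≻ₚ-∼ₚ-trans f≻g g∼h)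
      ≻-trans s≻t@(wpo2c _ _ f∼g ss≻ts) t≻u@(wpo2c _ t≻us g∼h ts≻us) =
        wpo2c (≻-≻⇒≥A s≻t t≻u) (≻-trans s≻t ∘ t≻us) (∼ₚ-trans f∼g g∼h) (lex-trans ss≻ts ts≻us)

      ⪰-≻-trans : ∀ {s t u} → s ⪰WPO t → t ≻WPO u → s ≻WPO u
      ⪰-≻-trans (inj₁ s≻t)  t≻u = ≻-trans s≻t t≻u
      ⪰-≻-trans (inj₂ refl) t≻u = t≻u

      ≻-⪰-trans : ∀ {s t u} → s ≻WPO t → t ⪰WPO u → s ≻WPO u
      ≻-⪰-trans s≻t (inj₁ t≻u) = ≻-trans s≻t t≻u
      ≻-⪰-trans s≻t (inj₂ refl) = s≻t

      ⪰-trans : ∀ {s t u} → s ⪰WPO t → t ⪰WPO u → s ⪰WPO u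
      ⪰-trans s⪰t (inj₁ t≻u)  = inj₁ (⪰-≻-trans s⪰t t≻u)
      ⪰-trans s⪰t (inj₂ refl) = s⪰t

      lex-trans : ∀ {xs ys zs} → Lex _≻WPO_ xs ys → Lex _≻WPO_ ys zs → Lex _≻WPO_ xs zs
      lex-trans (lex-here _)     lex-done         = lex-done
      lex-trans (lex-next _ _)   lex-done         = lex-done
      lex-trans (lex-here x≻y)   (lex-here y≻z)   = lex-here (≻-trans x≻y y≻z)
      lex-trans (lex-here x≻y)   (lex-next y⪰z _) = lex-here (≻-⪰-trans x≻y y⪰z)
      lex-trans (lex-next x⪰y _) (lex-here y≻z)   = lex-here (⪰-≻-trans x⪰y y≻z)
      lex-trans (lex-next x⪰y xs≻ys) (lex-next y⪰z ys≻zs) =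
        lex-next (⪰-trans x⪰y y⪰z) (lex-trans xs≻ys ys≻zs)

    private
      ≥A-stable : ∀ s t θ → s ≥A t → (s ⟨ θ ⟩) ≥A (t ⟨ θ ⟩)
      ≥A-stable s t θ s≥t = eval-stable _≤_ s t s≥t θ

      >A-stable : ∀ s t θ → s >A t → (s ⟨ θ ⟩) >A (t ⟨ θ ⟩)
      >A-stable s t θ s>t = eval-stable _<_ s t s>t θ

    mutual
      ≻-stable : ∀ {s t} → s ≻WPO t → (θ : Subst) → (s ⟨ θ ⟩) ≻WPO (t ⟨ θ ⟩)
      ≻-stable {s} {t} (wpo1 s>t) θ = wpo1 (>A-stable s t θ s>t)
      ≻-stable {fun f ss} {t} (wpo2a s≥t i sᵢ⪰t) θ =
        wpo2a (≥A-stable (fun f ss) t θ s≥t) i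
          (subst (_⪰WPO (t ⟨ θ ⟩)) (sym (lookup-substs ss i θ)) (⪰-stable sᵢ⪰t θ))
      ≻-stable {fun f ss} {fun g ts} (wpo2b s≥t s≻ts f≻g) θ =
        wpo2b (≥A-stable (fun f ss) (fun g ts) θ s≥t) (args-stable ts s≻ts θ) f≻g
      ≻-stable {fun f ss} {fun g ts} (wpo2c s≥t s≻ts f∼g ss≻ts) θ =
        wpo2c (≥A-stable (fun f ss) (fun g ts) θ s≥t) (args-stable ts s≻ts θ) f∼g
          (subst₂ (Lex _≻WPO_) (sym (applyStatus-substs σ f ss θ)) (sym (applyStatus-substs σ g ts θ))
            (lex-stable ss≻ts θ))

      args-stable : ∀ {s k} (ts : Vec Term k) → (∀ j → s ≻WPO lookup ts j) → (θ : Subst) →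
                    ∀ j → (s ⟨ θ ⟩) ≻WPO lookup (substs ts θ) j
      args-stable {s} ts s≻ts θ j =
        subst ((s ⟨ θ ⟩) ≻WPO_) (sym (lookup-substs ts j θ)) (≻-stable (s≻ts j) θ)

      ⪰-stable : ∀ {s t} → s ⪰WPO t → (θ : Subst) → (s ⟨ θ ⟩) ⪰WPO (t ⟨ θ ⟩)
      ⪰-stable (inj₁ s≻t)  θ = inj₁ (≻-stable s≻t θ)
      ⪰-stable (inj₂ refl) θ = inj₂ refl

      lex-stable : ∀ {xs ys} → Lex _≻WPO_ xs ys → (θ : Subst) →
                   Lex _≻WPO_ (List.map (_⟨ θ ⟩) xs) (List.map (_⟨ θ ⟩) ys)
      lex-stable lex-done              θ = lex-done
      lex-stable (lex-here x≻y)        θ = lex-here (≻-stable x≻y θ)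
      lex-stable (lex-next x⪰y xs≻ys)  θ = lex-next (⪰-stable x⪰y θ) (lex-stable xs≻ys θ)

    ≻-monotonic : ∀ {s t} → s ≻WPO t → ∀ f (us : Vec Term (ar f)) (i : Fin (ar f)) →
                  fun f (us [ i ]≔ s) ≻WPO fun f (us [ i ]≔ t)
    ≻-monotonic {s} {t} s≻t f us i = wpo2c S≥T S≻Tⱼ ∼ₚ-refl Sσ≻Tσ
      where
      S T : Vec Term (ar f)
      S = us [ i ]≔ s
      T = us [ i ]≔ t
      π = σ f

      S⪰T : ∀ j → lookup S j ⪰WPO lookup T j
      S⪰T = update-⪰ {_≻_ = _≻WPO_} s≻t us i

      S≥T : fun f S ≥A fun f T
      S≥T α α∈ = +-monoʳ-≤ (w f) (evalSum-update-mono α us i (≻⇒≥A s≻t α α∈))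

      S≻Tⱼ : ∀ j → fun f S ≻WPO lookup T j
      S≻Tⱼ j = ≻-⪰-trans (≻-subterm f S j) (S⪰T j)

      Sᵢ≻Tᵢ : lookup S (π ⟨$⟩ʳ (π ⟨$⟩ˡ i)) ≻WPO lookup T (π ⟨$⟩ʳ (π ⟨$⟩ˡ i))
      Sᵢ≻Tᵢ rewrite inverseʳ π {i} | lookup∘update i us s | lookup∘update i us t = s≻t

      Sσ≻Tσ : Lex _≻WPO_ (applyStatus σ f S) (applyStatus σ f T)
      Sσ≻Tσ = lex-tabulate (S⪰T ∘ (π ⟨$⟩ʳ_)) (π ⟨$⟩ˡ i) Sᵢ≻Tᵢ

    SN : Term → Set
    SN = Acc (flip _≻WPO_)

    var-SN : ∀ x → SN (var x)
    var-SN x = acc λ ()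

    ⪰-SN : ∀ {s t} → s ⪰WPO t → SN s → SN t
    ⪰-SN (inj₁ s≻t)  (acc <s) = <s s≻t
    ⪰-SN (inj₂ refl) s-SN     = s-SN

    maxArity : ℕ
    maxArity = max 0 (List.map ar (allFin nΣ))

    StatusLex : Rel (List Term) 0ℓ
    StatusLex = BoundedLex _≻WPO_ maxArity

    status-lexDomain : ∀ f ss → (∀ i → SN (lookup ss i)) → LexDomain _≻WPO_ maxArity (applyStatus σ f ss)
    status-lexDomain f ss ss-SN =
      subst (_≤ maxArity) (sym (length-toList (tabulate {n = ar f} _)))
            (All.lookup (xs≤max 0 _) (∈-map⁺ ar (∈-allFin f))) ,
      toList⁺ (tabulate⁺ (ss-SN ∘ (σ f ⟨$⟩ʳ_)))

    status-acc : ∀ f ss → (∀ i → SN (lookup ss i)) → Acc StatusLex (applyStatus σ f ss)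
    status-acc f ss ss-SN = lexDomain-acc _≻WPO_ maxArity _ (status-lexDomain f ss ss-SN)

    -- The accessibility proof for the precedence is taken at a fixed f of
    -- the ∼-class of the head symbol g, so that ∼-steps keep it unchanged.
    mutual
      fun-SN : ∀ {n} → Acc _<_ n → ∀ {f} → Acc (flip (StrictPart _≿_)) f →
               ∀ {g ts} → EquivPart _≿_ f g → Acc StatusLex (applyStatus σ g ts) →
               eval least (fun g ts) ≤ n → (∀ j → SN (lookup ts j)) → SN (fun g ts)
      fun-SN n-acc f-acc {g} {ts} f∼g ts-acc ≤n ts-SN =
        acc λ {u} → term-induction {P = λ u → fun g ts ≻WPO u → SN u}
          (λ x _ → var-SN x)
          (λ h us us-SN t≻u → reduct-SN n-acc f-acc f∼g ts-acc ≤n ts-SN t≻u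
                                (λ j → us-SN j (≻-trans t≻u (≻-subterm h us j))))
          u

      reduct-SN : ∀ {n} → Acc _<_ n → ∀ {f} → Acc (flip (StrictPart _≿_)) f →
                  ∀ {g ts} → EquivPart _≿_ f g → Acc StatusLex (applyStatus σ g ts) →
                  eval least (fun g ts) ≤ n → (∀ j → SN (lookup ts j)) →
                  ∀ {h us} → fun g ts ≻WPO fun h us → (∀ j → SN (lookup us j)) → SN (fun h us)
      reduct-SN (acc <n) _ _ _ ≤n _ {h} {us} (wpo1 t>u) us-SN =
        fun-SN (<n (<-≤-trans (t>u least least-inCarrier) ≤n)) (wfStrictPart h) ∼ₚ-refl
          (status-acc h us us-SN) ≤-refl us-SN
      reduct-SN _ _ _ _ _ ts-SN (wpo2a _ i tᵢ⪰u) _ = ⪰-SN tᵢ⪰u (ts-SN i)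
      reduct-SN n-acc (acc ≺f) f∼g _ ≤n _ {h} {us} (wpo2b t≥u _ g≻h) us-SN =
        fun-SN n-acc (≺f (∼ₚ-≻ₚ-trans f∼g g≻h)) ∼ₚ-refl (status-acc h us us-SN)
          (≤-trans (t≥u least least-inCarrier) ≤n) us-SN
      reduct-SN n-acc f-acc f∼g (acc <ts) ≤n _ {h} {us} (wpo2c t≥u _ g∼h ts≻us) us-SN =
        fun-SN n-acc f-acc (∼ₚ-trans f∼g g∼h) (<ts (ts≻us , status-lexDomain h us us-SN))
          (≤-trans (t≥u least least-inCarrier) ≤n) us-SN

    ≻-wellFounded : WellFounded (flip _≻WPO_)
    ≻-wellFounded = term-induction var-SN λ f ts ts-SN →
      fun-SN (<-wellFounded _) (wfStrictPart f) ∼ₚ-refl (status-acc f ts ts-SN) ≤-refl ts-SN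

    isReductionOrder : IsReductionOrder _≻WPO_
    isReductionOrder = record
      { isStrictOrder = record
        { isEquivalence = ≡-isEquivalence
        ; irrefl        = λ s≡t → wf⇒irrefl (resp₂ _) sym ≻-wellFounded (sym s≡t)
        ; trans         = ≻-trans
        ; <-resp-≈      = resp₂ _≻WPO_
        }
      ; wellFounded = ≻-wellFounded
      ; monotonic   = ≻-monotonic
      ; stable      = ≻-stable
      }

corollary1 : {nΣ : ℕ} (ar : Fin nΣ → ℕ) (V : Set) →
    (W : Terms.WeightFunction ar V) (P : Terms.QuasiPrecedence ar V) (σ : Terms.Status ar V) →
    Terms.IsReductionOrder ar V (Terms.WPO._≻WPO_ ar V W P σ)
corollary1 ar V W P σ = TermProperties.WPOProperties.isReductionOrder ar V W P σ
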